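{- Let $\mathcal{P}$ be a profile of unrooted phylogenetic trees whose display graph $G(\mathcal{P})$ is connected, and let $F_1,F_2$ be two parallel legal minimal cuts of $G(\mathcal{P})$. Then the splits $\Sigma(F_1)$ and $\Sigma(F_2)$ are compatible.
   Context: A phylogenetic tree is an unrooted tree whose leaves are bijectively labeled; a profile $\mathcal{P}$ is a finite collection of phylogenetic trees, $\mathcal{L}(\mathcal{P})$ the union of their label sets. The display graph $G(\mathcal{P})$ is the union of the trees of $\mathcal{P}$, where leaves with the same label are identified and all other vertices of different trees are distinct; leaf vertices are the labels. A minimal cut of a connected graph is an inclusion-minimal disconnecting edge set; minimal cuts $F,F'$ of $G$ are parallel if $G-F$ has at most one connected component $H$ with $E(H)\cap F'\neq\emptyset$. A cut $F$ of $G(\mathcal{P})$ is legal if (LC1) for every $T\in\mathcal{P}$ the edges of $T$ in $F$ are incident on a common vertex and (LC2) every component of $G(\mathcal{P})-F$ contains at least one edge. For a legal minimal cut $F$ with components $G_1,G_2$ of $G(\mathcal{P})-F$, $\Sigma(F)$ is the split $\mathcal{L}(G_1)|\mathcal{L}(G_2)$ of $\mathcal{L}(\mathcal{P})$, where $\mathcal{L}(G_i)$ is the set of leaf vertices in $G_i$. Two splits $A_1|A_2$ and $B_1|B_2$ are compatible iff at least one of $A_1\cap B_1$, $A_1\cap B_2$, $A_2\cap B_1$, $A_2\cap B_2$ is empty. -}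

module Defs where

open import Data.Nat using (ℕ)
open import Data.Fin using (Fin)
open import Data.Bool using (Bool; true; false)
open import Data.Sum using (_⊎_; inj₁; inj₂)
open import Data.Product using (Σ; Σ-syntax; ∃; ∃-syntax; _×_; _,_; proj₁; proj₂)
open import Data.Unit using (⊤)
open import Relation.Binary.PropositionalEquality using (_≡_; _≢_)
open import Relation.Nullary using (¬_)

-- Finite multigraphs given by an endpoint map, and reachability in the
-- spanning subgraph keeping exactly the edges satisfying `keep`
-- (all vertices are kept).

Adj : {V : Set} → V × V → V → V → Set
Adj (a , b) u v = (a ≡ u × b ≡ v) ⊎ (b ≡ u × a ≡ v)

Inc : {V : Set} → V × V → V → Set
Inc (a , b) v = (a ≡ v) ⊎ (b ≡ v)

data Reach {V E : Set} (ends : E → V × V) (keep : E → Set) : V → V → Set where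
  here : ∀ {v} → Reach ends keep v v
  step : ∀ {u v w} (e : E) → keep e → Adj (ends e) u v →
         Reach ends keep v w → Reach ends keep u w

record Graph : Set₁ where
  field
    V    : Set
    E    : Set
    gends : E → V × V

-- The vertices of a tree are `inj₁ ℓ` for labels ℓ with inT ℓ ≡ true
-- (the leaves, identified with their labels) and `inj₂ v` for v : Fin nI
-- (the internal vertices).

TV : ℕ → ℕ → Set
TV L nI = Fin L ⊎ Fin nI

IsVertex : {L nI : ℕ} → (Fin L → Bool) → TV L nI → Set
IsVertex inT (inj₁ ℓ) = inT ℓ ≡ true
IsVertex inT (inj₂ v) = ⊤

DegLe1 : {V : Set} {m : ℕ} → (Fin m → V × V) → V → Set
DegLe1 ends v = ∀ e e' → Inc (ends e) v → Inc (ends e') v → e ≡ e'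

DegGe2 : {V : Set} {m : ℕ} → (Fin m → V × V) → V → Set
DegGe2 {m = m} ends v = Σ[ e ∈ Fin m ] Σ[ e' ∈ Fin m ] (e ≢ e' × Inc (ends e) v × Inc (ends e') v)

record PhyloTree (L : ℕ) : Set where
  field
    inT  : Fin L → Bool
    nI   : ℕ
    m    : ℕ
    ends : Fin m → TV L nI × TV L nI

  field
    endsOK    : ∀ e → IsVertex inT (proj₁ (ends e)) × IsVertex inT (proj₂ (ends e))
    nonempty  : ∃[ ℓ ] inT ℓ ≡ true
    connected : ∀ u v → IsVertex inT u → IsVertex inT v → Reach ends (λ _ → ⊤) u v
    -- ... and acyclic (no edge lies on a cycle: every edge is a bridge;
    -- in particular there are no loops and no parallel edges)
    acyclic   : ∀ e → ¬ Reach ends (λ e' → e' ≢ e) (proj₁ (ends e)) (proj₂ (ends e))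
    -- the leaves (vertices of degree ≤ 1) are exactly the label vertices,
    -- so the leaves are bijectively labelled by {ℓ | inT ℓ ≡ true}
    labelLeaf    : ∀ ℓ → inT ℓ ≡ true → DegLe1 ends (inj₁ ℓ)
    internalNonLeaf : ∀ v → DegGe2 ends (inj₂ v)

open PhyloTree public

-- A profile: finitely many trees over label universe Fin L, such that
-- L(P) = Fin L (every label occurs in some tree).
record Profile (L : ℕ) : Set where
  field
    k     : ℕ
    tree  : Fin k → PhyloTree L
    cover : ∀ (ℓ : Fin L) → ∃[ i ] inT (tree i) ℓ ≡ true

open Profile public

-- Display graph: leaves with equal labels identified, all other
-- vertices of different trees distinct.

module _ {L : ℕ} (P : Profile L) where

  DV : Set
  DV = Fin L ⊎ Σ[ i ∈ Fin (k P) ] Fin (nI (tree P i))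

  DE : Set
  DE = Σ[ i ∈ Fin (k P) ] Fin (m (tree P i))

  embed : (i : Fin (k P)) → TV L (nI (tree P i)) → DV
  embed i (inj₁ ℓ) = inj₁ ℓ
  embed i (inj₂ v) = inj₂ (i , v)

  dends : DE → DV × DV
  dends (i , e) = embed i (proj₁ (ends (tree P i) e)) , embed i (proj₂ (ends (tree P i) e))

  displayGraph : Graph
  displayGraph = record { V = DV ; E = DE ; gends = dends }

module _ (G : Graph) where
  open Graph G

  EdgeSet : Set
  EdgeSet = E → Bool

  _⊆E_ : EdgeSet → EdgeSet → Set
  F ⊆E F' = ∀ e → F e ≡ true → F' e ≡ true

  ReachMinus : EdgeSet → V → V → Set
  ReachMinus F = Reach gends (λ e → F e ≡ false)

  Connected : Set
  Connected = ∀ u v → Reach gends (λ _ → ⊤) u v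

  Disconnecting : EdgeSet → Set
  Disconnecting F = Σ[ u ∈ V ] Σ[ v ∈ V ] ¬ ReachMinus F u v

  MinimalCut : EdgeSet → Set
  MinimalCut F = Disconnecting F × (∀ F' → F' ⊆E F → Disconnecting F' → F ⊆E F')

  -- F, F' parallel: at most one component H of G - F has an edge of F'
  -- (i.e. all edges of F' lying in G - F lie in one component of G - F)
  Parallel : EdgeSet → EdgeSet → Set
  Parallel F F' = ∀ e e' → F' e ≡ true → F e ≡ false → F' e' ≡ true → F e' ≡ false →
                  ReachMinus F (proj₁ (gends e)) (proj₁ (gends e'))

  -- a labelling of the vertices by Bool whose classes are exactly the
  -- connected components of G - F (the two components G₁ = true-side,
  -- G₂ = false-side)
  record Sides (F : EdgeSet) : Set where
    field
      side     : V → Bool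
      sameSide : ∀ u v → ReachMinus F u v → side u ≡ side v
      sameComp : ∀ u v → side u ≡ side v → ReachMinus F u v



module _ {L : ℕ} (P : Profile L) where

  G : Graph
  G = displayGraph P

  LC1 : EdgeSet G → Set
  LC1 F = ∀ (i : Fin (k P)) → Σ[ x ∈ DV P ] (∀ e → F (i , e) ≡ true → Inc (dends P (i , e)) x)

  LC2 : EdgeSet G → Set
  LC2 F = ∀ (x : DV P) → Σ[ e ∈ DE P ] (F e ≡ false × ReachMinus G F x (proj₁ (dends P e)))

  Legal : EdgeSet G → Set
  Legal F = LC1 F × LC2 F

  -- Σ(F) = L(G₁) | L(G₂), represented by the side of each label
  Split : Set
  Split = Fin L → Bool

  splitOf : {F : EdgeSet G} → Sides G F → Split
  splitOf s ℓ = Sides.side s (inj₁ ℓ)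

-- A split A₁|A₂ of Fin L represented by s : Fin L → Bool with
-- A₁ = {ℓ | s ℓ ≡ true}, A₂ = {ℓ | s ℓ ≡ false}.
EmptyMeet : {L : ℕ} → (Fin L → Bool) → Bool → (Fin L → Bool) → Bool → Set
EmptyMeet s a t b = ∀ ℓ → ¬ (s ℓ ≡ a × t ℓ ≡ b)

Compatible : {L : ℕ} → (Fin L → Bool) → (Fin L → Bool) → Set
Compatible s t = EmptyMeet s true t true ⊎ EmptyMeet s true t false
               ⊎ EmptyMeet s false t true ⊎ EmptyMeet s false t false

-- Since F₁ and F₂ are parallel, one of the two components of G − F₁ contains
-- no edge of F₂. A path inside that component therefore avoids F₂ as well, so
-- all labels on that side of Σ(F₁) lie on a single side of Σ(F₂), which
-- leaves one of the four intersections of the two splits empty.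
module Submission where

open import Defs
open import Data.Nat using (ℕ)
open import Data.Product using (_×_; _,_; proj₁; Σ; ∃)
open import Data.Sum using (inj₁; inj₂)
open import Data.Bool using (Bool; true; false; not; _≟_)
open import Data.Bool.Properties using (not-¬)
open import Data.Fin using (Fin)
open import Data.Fin.Properties using (any?)
open import Data.Empty using (⊥-elim)
open import Relation.Nullary using (Dec; yes; no)
open import Relation.Nullary.Decidable using (_×-dec_)
open import Relation.Binary.PropositionalEquality using (_≡_; _≢_; refl; sym; trans)

EmptyMeet⇒Compatible : {L : ℕ} {s t : Fin L → Bool} (a b : Bool) →
  EmptyMeet s a t b → Compatible s t
EmptyMeet⇒Compatible true  true  h = inj₁ h
EmptyMeet⇒Compatible true  false h = inj₂ (inj₁ h)
EmptyMeet⇒Compatible false true  h = inj₂ (inj₂ (inj₁ h))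
EmptyMeet⇒Compatible false false h = inj₂ (inj₂ (inj₂ h))

constantOnFibre⇒Compatible : {L : ℕ} (s t : Fin L → Bool) (c : Bool) →
  (∀ ℓ ℓ' → s ℓ ≡ c → s ℓ' ≡ c → t ℓ ≡ t ℓ') → Compatible s t
constantOnFibre⇒Compatible s t c const with any? (λ ℓ → s ℓ ≟ c)
... | no  ¬fibre       = EmptyMeet⇒Compatible c true λ ℓ (sℓ , _) → ¬fibre (ℓ , sℓ)
... | yes (ℓ₀ , sℓ₀) = EmptyMeet⇒Compatible c (not (t ℓ₀))
  λ ℓ (sℓ , tℓ) → not-¬ (sym (const ℓ₀ ℓ sℓ₀ sℓ)) tℓ

module _ (𝒢 : Graph) {F₁ F₂ : EdgeSet 𝒢} (s₁ : Sides 𝒢 F₁) where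
  open Graph 𝒢
  open Sides s₁

  -- Testing the first endpoint suffices: both ends of an edge of G − F₁ lie
  -- on the same side.
  CleanSide : Bool → Set
  CleanSide c = ∀ e → F₁ e ≡ false → F₂ e ≡ true → side (proj₁ (gends e)) ≢ c

  firstEnd-sameSide : ∀ {u v} e → F₁ e ≡ false → Adj (gends e) u v →
    side (proj₁ (gends e)) ≡ side u
  firstEnd-sameSide e kept (inj₁ (refl , _)) = refl
  firstEnd-sameSide e kept adj@(inj₂ (_ , refl)) = sym (sameSide _ _ (step e kept adj here))

  cleanSide-reach : ∀ {c u v} → CleanSide c → side u ≡ c →
    ReachMinus 𝒢 F₁ u v → ReachMinus 𝒢 F₂ u v
  cleanSide-reach clean su here = here
  cleanSide-reach clean su (step e kept adj r) with F₂ e in inF₂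
  ... | false = step e inF₂ adj
        (cleanSide-reach clean (trans (sym (sameSide _ _ (step e kept adj here))) su) r)
  ... | true  = ⊥-elim (clean e kept inF₂ (trans (firstEnd-sameSide e kept adj) su))

  parallel⇒cleanSide : Parallel 𝒢 F₁ F₂ →
    Dec (∃ λ e → F₁ e ≡ false × F₂ e ≡ true) → Σ Bool CleanSide
  parallel⇒cleanSide par (no ¬crossing) = true , λ e kept inF₂ _ → ¬crossing (e , kept , inF₂)
  parallel⇒cleanSide par (yes (e₀ , kept₀ , inF₂₀)) =
    not (side (proj₁ (gends e₀))) ,
    λ e kept inF₂ → not-¬ (sym (sameSide _ _ (par e₀ e inF₂₀ kept₀ inF₂ kept)))

  cleanSide⇒sameSide : ∀ {c} (s₂ : Sides 𝒢 F₂) → CleanSide c →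
    ∀ u v → side u ≡ c → side v ≡ c → Sides.side s₂ u ≡ Sides.side s₂ v
  cleanSide⇒sameSide s₂ clean u v su sv =
    Sides.sameSide s₂ u v (cleanSide-reach clean su (sameComp u v (trans su (sym sv))))

crossingEdge? : {L : ℕ} (P : Profile L) (F₁ F₂ : EdgeSet (G P)) →
  Dec (∃ λ e → F₁ e ≡ false × F₂ e ≡ true)
crossingEdge? P F₁ F₂ with any? (λ i → any? (λ e → (F₁ (i , e) ≟ false) ×-dec (F₂ (i , e) ≟ true)))
... | yes (i , e , kept , inF₂) = yes ((i , e) , kept , inF₂)
... | no  ¬crossing             = no λ { ((i , e) , kept , inF₂) → ¬crossing (i , e , kept , inF₂) }

lemma7 : {L : ℕ} (P : Profile L) → Connected (G P) →
    (F₁ F₂ : EdgeSet (G P)) →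
    MinimalCut (G P) F₁ → Legal P F₁ →
    MinimalCut (G P) F₂ → Legal P F₂ →
    Parallel (G P) F₁ F₂ →
    (s₁ : Sides (G P) F₁) (s₂ : Sides (G P) F₂) →
    Compatible (splitOf P s₁) (splitOf P s₂)
lemma7 P _ F₁ F₂ _ _ _ _ par s₁ s₂ =
  let c , clean = parallel⇒cleanSide (G P) s₁ par (crossingEdge? P F₁ F₂)
  in constantOnFibre⇒Compatible (splitOf P s₁) (splitOf P s₂) c
       λ ℓ ℓ' → cleanSide⇒sameSide (G P) s₁ s₂ clean (inj₁ ℓ) (inj₁ ℓ')
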